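{- Let $c_1,c_2,d_1,d_2\in\mathbb{Z}$ with $c_1-c_2>d_1-d_2\ge0$, and let $a=c_1-c_2-d_1+d_2$. If $\lambda=(\lambda^{(1)},\lambda^{(2)})\in\mathcal{C}_{(0|c_1,c_2)}\cap\mathcal{C}_{(0|d_1,d_2)}$, then $\operatorname{hk}_a(\lambda^{(k)})\le d_1-d_2$ for $k=1,2$.
   Context: For a partition $\nu$ and $a\ge1$, $\operatorname{hk}_a(\nu)$ is the number of hooks of $\nu$ of length $a$ (the hook of a node $(i,j)$ being the set of nodes directly right of or below it, including itself). A bipartition is a pair $(\lambda^{(1)},\lambda^{(2)})$ of partitions, with nodes $(i,j,k)$ for $j\le\lambda^{(k)}_i$. For $(c_1,c_2)\in\mathbb{Z}^2$, the $(0\,|\,c_1,c_2)$-residue of $(i,j,k)$ is the integer $j-i+c_k$; the content is the multiset of residues of the nodes; a bipartition is a $(0\,|\,c_1,c_2)$-core if no other bipartition has the same content. $\mathcal{C}_{(0|c_1,c_2)}$ is the set of such cores. -}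

module Defs where

open import Data.Nat using (ℕ; zero; suc; _∸_; _≤?_; _≥_; _≟_) renaming (_+_ to _+ℕ_)
open import Data.Integer as ℤ using (ℤ; +_)
open import Data.List using (List; []; _∷_; _++_; map; upTo; filter; length)
open import Data.List.Relation.Unary.All using (All)
open import Data.List.Relation.Unary.Linked using (Linked)
open import Data.List.Relation.Binary.Permutation.Propositional using (_↭_)
open import Data.Product using (_×_; _,_; proj₁; proj₂)
open import Relation.Binary.PropositionalEquality using (_≡_)

record Partition : Set where
  constructor mkPartition
  field
    parts      : List ℕ
    decreasing : Linked _≥_ parts
    positive   : All (λ p → p ≥ 1) parts
open Partition public

-- For the node in column j (1-indexed) of a row with part p, whose lower
-- rows are `rest`: arm = p ∸ j, leg = #{rows q below with q ≥ j}.
hookLengths : List ℕ → List ℕ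
hookLengths [] = []
hookLengths (p ∷ rest) =
  map (λ j → suc ((p ∸ j) +ℕ length (filter (j ≤?_) rest))) (map suc (upTo p))
  ++ hookLengths rest

hk : ℕ → Partition → ℕ
hk a ν = length (filter (_≟ a) (hookLengths (parts ν)))

-- Residues j - i + c of the nodes (i,j) of a partition with charge c;
-- r is the 0-based index of the current row (so i = r + 1, and j - 1 = k).
residuesFrom : ℤ → ℕ → List ℕ → List ℤ
residuesFrom c r [] = []
residuesFrom c r (p ∷ rest) =
  map (λ k → (c ℤ.+ + k) ℤ.- + r) (upTo p) ++ residuesFrom c (suc r) rest

residues : ℤ → Partition → List ℤ
residues c ν = residuesFrom c 0 (parts ν)

Bipartition : Set
Bipartition = Partition × Partition

-- The (0 | c₁,c₂)-content of a bipartition, as a list of residues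
-- (a multiset, compared up to permutation).
content : ℤ × ℤ → Bipartition → List ℤ
content (c₁ , c₂) (λ₁ , λ₂) = residues c₁ λ₁ ++ residues c₂ λ₂

SameBipartition : Bipartition → Bipartition → Set
SameBipartition (λ₁ , λ₂) (μ₁ , μ₂) = (parts λ₁ ≡ parts μ₁) × (parts λ₂ ≡ parts μ₂)

IsCore : ℤ × ℤ → Bipartition → Set
IsCore c λ' = ∀ (μ : Bipartition) → content c μ ↭ content c λ' → SameBipartition μ λ'

-- Encode a partition λ with charge c by its abacus, the set of positions
-- λᵢ − i + c (i ≥ 1). A hook of length a of λ joins a bead b to the gap b − a, and
-- distinct hooks give distinct such pairs. The number of nodes of residue t, plus the
-- number of beads ≥ t of the empty partition, is the number of beads ≥ t; so the
-- (0 | c₁,c₂)-content of (λ¹,λ²) determines the multiset union of the two abaci.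
-- Hence, for c₁ = c₂ + k, a core admits no exchange of a bead between the two abaci,
-- which forces the abacus of (λ², c₂) into that of (λ¹, c₁). Applying this to both
-- charges and shifting gives: every bead of (λ², d₂) is a bead of (λ¹, d₁), and so is
-- every position a below it. The beads b of (λ¹, d₁) above a gap b − a, and the gaps
-- b − a below beads b of (λ², d₂), therefore lie in the abacus of (λ¹, d₁) but outside
-- that of (λ², d₂); cut at a common floor, the former has exactly d₁ − d₂ more beads.

module Submission where

open import Defs
open import Data.Empty using (⊥; ⊥-elim)
open import Data.Integer using (ℤ; +_; _+_; _-_; -_; _≤_; _<_; _>_; _≥_; ∣_∣; +≤+; +<+)
import Data.Integer.Properties as ZP
open import Data.Integer.Tactic.RingSolver using (solve-∀)
open import Data.List using (List; []; _∷_; _++_; map; filter; length; replicate; upTo; applyUpTo)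
import Data.List.Properties as LP
open import Data.List.Membership.Propositional using (_∈_; _∉_; find)
open import Data.List.Membership.Propositional.Properties using (∈-∃++; ∈-++⁺ˡ; ∈-++⁻; ∈-map⁺; ∈-map⁻; ∈-filter⁻; ∈-upTo⁻)
open import Data.List.Membership.DecPropositional ZP._≟_ using (_∈?_)
open import Data.List.Relation.Unary.All using (All; []; _∷_; all?)
import Data.List.Relation.Unary.All as All
open import Data.List.Relation.Unary.All.Properties using (¬All⇒Any¬)
open import Data.List.Relation.Unary.AllPairs using (AllPairs; []; _∷_)
import Data.List.Relation.Unary.AllPairs as AllPairs
open import Data.List.Relation.Unary.Any using (Any; here; there)
open import Data.List.Relation.Unary.Linked using (Linked; []; [-]; _∷_)
import Data.List.Relation.Unary.Linked as Linked
open import Data.List.Relation.Unary.Linked.Properties using (Linked⇒AllPairs)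
open import Data.List.Relation.Unary.Unique.Propositional using (Unique)
import Data.List.Relation.Unary.Unique.Propositional.Properties as Unique
open import Data.List.Relation.Binary.Disjoint.Propositional using (Disjoint)
open import Data.List.Relation.Binary.Permutation.Propositional using (_↭_; ↭-refl; ↭-reflexive; ↭-trans; ↭-sym; prep; swap; ↭⇒↭ₛ)
open import Data.List.Relation.Binary.Permutation.Propositional.Properties using (shift; ∈-resp-↭; All-resp-↭; filter-↭; ↭-length; ++⁺)
import Data.List.Relation.Binary.Permutation.Setoid.Properties as PermutationSetoid
import Relation.Binary.Properties.DecTotalOrder ZP.≤-decTotalOrder as ℤ-Order
open import Data.List.Sort ℤ-Order.≥-decTotalOrder using (sort; sort-↭; sort-↗)
open import Data.Nat using (ℕ; zero; suc; _∸_; z≤n; s≤s)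
  renaming (_+_ to _+ℕ_; _≤_ to _≤ℕ_; _<_ to _<ℕ_; _≥_ to _≥ℕ_; _≤?_ to _≤ℕ?_; _≟_ to _≟ℕ_)
import Data.Nat.Properties as NP
import Data.Nat.Tactic.RingSolver as ℕ-Solver
open import Data.Product using (Σ; ∃; _×_; _,_; proj₁; proj₂)
open import Data.Sum using (_⊎_; inj₁; inj₂; [_,_]′)
open import Data.Unit using (⊤; tt)
open import Level using (0ℓ)
open import Relation.Binary.Definitions using (DecidableEquality; tri<; tri≈; tri>)
open import Relation.Binary.PropositionalEquality using (_≡_; refl; sym; trans; cong; cong₂; subst; subst₂; setoid; module ≡-Reasoning)
open import Relation.Nullary using (¬_; Dec; yes; no)
open import Relation.Nullary.Decidable using (¬?; _⊎-dec_)
open import Relation.Unary using (Pred; Decidable)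

𝟙 : {P : Set} → Dec P → ℕ
𝟙 (yes _) = 1
𝟙 (no _)  = 0

module _ {A : Set} {P : Pred A 0ℓ} (P? : Decidable P) where

  count : List A → ℕ
  count xs = length (filter P? xs)

  count-∷ : ∀ x xs → count (x ∷ xs) ≡ 𝟙 (P? x) +ℕ count xs
  count-∷ x xs with P? x
  ... | yes _ = refl
  ... | no _  = refl

  count-++ : ∀ xs ys → count (xs ++ ys) ≡ count xs +ℕ count ys
  count-++ xs ys = trans (cong length (LP.filter-++ P? xs ys)) (LP.length-++ (filter P? xs))

  count-↭ : ∀ {xs ys} → xs ↭ ys → count xs ≡ count ys
  count-↭ p = ↭-length (filter-↭ P? p)

  count>0⇒Any : ∀ xs → 0 <ℕ count xs → Any P xs
  count>0⇒Any (x ∷ xs) pos with P? x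
  ... | yes px = here px
  ... | no _   = there (count>0⇒Any xs pos)

  count-none : ∀ xs → (∀ {x} → x ∈ xs → ¬ P x) → count xs ≡ 0
  count-none xs ¬P = cong length (LP.filter-none P? (All.tabulate ¬P))

  count-unique≤1 : ∀ xs → Unique xs → (∀ {x y} → x ∈ xs → y ∈ xs → P x → P y → x ≡ y) → count xs ≤ℕ 1
  count-unique≤1 []       _          _    = z≤n
  count-unique≤1 (x ∷ xs) (x∉ ∷ uxs) same with P? x
  ... | yes px = s≤s (NP.≤-reflexive (count-none xs λ y∈ py → All.lookup x∉ y∈ (same (here refl) (there y∈) px py)))
  ... | no _   = count-unique≤1 xs uxs (λ x∈ y∈ → same (there x∈) (there y∈))

module _ {A : Set} {P Q : Pred A 0ℓ} (P? : Decidable P) (Q? : Decidable Q) where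

  count-mono : ∀ xs → (∀ {x} → x ∈ xs → P x → Q x) → count P? xs ≤ℕ count Q? xs
  count-mono []       _   = z≤n
  count-mono (x ∷ xs) P⇒Q with P? x | Q? x
  ... | yes _  | yes _  = s≤s (count-mono xs (λ x∈ → P⇒Q (there x∈)))
  ... | yes px | no ¬qx = ⊥-elim (¬qx (P⇒Q (here refl) px))
  ... | no _   | yes _  = NP.m≤n⇒m≤1+n (count-mono xs (λ x∈ → P⇒Q (there x∈)))
  ... | no _   | no _   = count-mono xs (λ x∈ → P⇒Q (there x∈))

count-map : {A B : Set} {P : Pred B 0ℓ} (P? : Decidable P) (f : A → B) →
            ∀ xs → count P? (map f xs) ≡ count (λ x → P? (f x)) xs
count-map P? f []       = refl
count-map P? f (x ∷ xs) with P? (f x)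
... | yes _ = cong suc (count-map P? f xs)
... | no _  = count-map P? f xs

∈⇒↭∷ : {A : Set} {x : A} {ys : List A} → x ∈ ys → ∃ λ zs → ys ↭ x ∷ zs
∈⇒↭∷ {x = x} x∈ with ∈-∃++ x∈
... | as , bs , refl = as ++ bs , shift x as bs

module Multiplicity {A : Set} (_≟_ : DecidableEquality A) where

  multiplicity : A → List A → ℕ
  multiplicity t = count (t ≟_)

  multiplicity-∷-self : ∀ x xs → 0 <ℕ multiplicity x (x ∷ xs)
  multiplicity-∷-self x xs with x ≟ x
  ... | yes _  = s≤s z≤n
  ... | no x≢x = ⊥-elim (x≢x refl)

  multiplicity-≡⇒↭ : ∀ xs ys → (∀ t → multiplicity t xs ≡ multiplicity t ys) → xs ↭ ys
  multiplicity-≡⇒↭ []       []       _    = ↭-refl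
  multiplicity-≡⇒↭ []       (y ∷ ys) same with subst (0 <ℕ_) (sym (same y)) (multiplicity-∷-self y ys)
  ... | ()
  multiplicity-≡⇒↭ (x ∷ xs) ys same
    with zs , ys↭ ← ∈⇒↭∷ (count>0⇒Any (x ≟_) ys (subst (0 <ℕ_) (same x) (multiplicity-∷-self x xs)))
    = ↭-trans (prep x (multiplicity-≡⇒↭ xs zs same′)) (↭-sym ys↭)
    where
    open ≡-Reasoning
    same′ : ∀ t → multiplicity t xs ≡ multiplicity t zs
    same′ t = NP.+-cancelˡ-≡ (𝟙 (t ≟ x)) _ _ (begin
      𝟙 (t ≟ x) +ℕ multiplicity t xs  ≡⟨ sym (count-∷ (t ≟_) x xs) ⟩
      multiplicity t (x ∷ xs)         ≡⟨ same t ⟩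
      multiplicity t ys               ≡⟨ count-↭ (t ≟_) ys↭ ⟩
      multiplicity t (x ∷ zs)         ≡⟨ count-∷ (t ≟_) x zs ⟩
      𝟙 (t ≟ x) +ℕ multiplicity t zs  ∎)

Unique-⊆⇒length-≤ : {A : Set} {xs ys : List A} → Unique xs → (∀ {x} → x ∈ xs → x ∈ ys) → length xs ≤ℕ length ys
Unique-⊆⇒length-≤ {xs = []}     _          _    = z≤n
Unique-⊆⇒length-≤ {xs = x ∷ xs} (x∉ ∷ uxs) xs⊆ with zs , ys↭ ← ∈⇒↭∷ (xs⊆ (here refl))
  = subst (suc (length xs) ≤ℕ_) (sym (↭-length ys↭)) (s≤s (Unique-⊆⇒length-≤ uxs xs⊆zs))
  where
  xs⊆zs : ∀ {y} → y ∈ xs → y ∈ zs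
  xs⊆zs {y} y∈ with ∈-resp-↭ ys↭ (xs⊆ (there y∈))
  ... | here y≡x = ⊥-elim (All.lookup x∉ y∈ (sym y≡x))
  ... | there y∈zs = y∈zs

∉⇒Unique-∷ : {A : Set} {x : A} {xs : List A} → x ∉ xs → Unique xs → Unique (x ∷ xs)
∉⇒Unique-∷ {xs = xs} x∉xs uniq = All.tabulate (λ y∈xs x≡y → x∉xs (subst (_∈ xs) (sym x≡y) y∈xs)) ∷ uniq

disjoint-⊆⇒length-≤ : {A : Set} {xs ys zs : List A} → Unique xs → Unique ys → Disjoint xs ys →
  (∀ {x} → x ∈ xs → x ∈ zs) → (∀ {y} → y ∈ ys → y ∈ zs) → length xs +ℕ length ys ≤ℕ length zs
disjoint-⊆⇒length-≤ {xs = xs} uxs uys disjoint xs⊆ ys⊆ =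
  subst (_≤ℕ _) (LP.length-++ xs)
    (Unique-⊆⇒length-≤ (Unique.++⁺ uxs uys disjoint) λ z∈ → [ xs⊆ , ys⊆ ]′ (∈-++⁻ xs z∈))

↭-exchange : {A : Set} (x y : A) (xs ys : List A) → (y ∷ xs) ++ (x ∷ ys) ↭ (x ∷ xs) ++ (y ∷ ys)
↭-exchange x y xs ys =
  ↭-trans (prep y (shift x xs ys)) (↭-trans (swap y x ↭-refl) (prep x (↭-sym (shift y xs ys))))

module _ {A : Set} {B : List A} {x : A} {xs : List A} (B↭ : B ↭ x ∷ xs) where

  Unique-replaceHead : Unique B → ∀ {y} → y ∉ B → Unique (y ∷ xs)
  Unique-replaceHead uniq y∉B with PermutationSetoid.Unique-resp-↭ (setoid A) (↭⇒↭ₛ B↭) uniq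
  ... | _ ∷ uniq-xs = ∉⇒Unique-∷ (λ y∈xs → y∉B (∈-resp-↭ (↭-sym B↭) (there y∈xs))) uniq-xs

  All-replaceHead : ∀ {P : A → Set} → All P B → ∀ {y} → P y → All P (y ∷ xs)
  All-replaceHead all-B py with All-resp-↭ B↭ all-B
  ... | _ ∷ all-xs = py ∷ all-xs

<1+⇒≤ : ∀ {t u} → t < u + + 1 → t ≤ u
<1+⇒≤ {t} {u} t<u+1 = subst₂ _≤_ (cancel t) (cancel′ u) (ZP.+-monoˡ-≤ (- + 1) (ZP.i<j⇒suc[i]≤j t<u+1))
  where
  cancel : ∀ t → (+ 1 + t) - + 1 ≡ t
  cancel = solve-∀
  cancel′ : ∀ u → (u + + 1) - + 1 ≡ u
  cancel′ = solve-∀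

x<x+pos : ∀ x {n} → 0 <ℕ n → x < x + + n
x<x+pos x 0<n = subst (_< x + + _) (ZP.+-identityʳ x) (ZP.+-monoʳ-< x (+<+ 0<n))

x-suc<x : ∀ x n → x - + suc n < x
x-suc<x x n = ZP.suc[i]≤j⇒i<j (subst (_≤ x) (sym (pred-cancel x (+ n))) (ZP.i-j≤i x (+ n)))
  where
  pred-cancel : ∀ x n → + 1 + (x - (+ 1 + n)) ≡ x - n
  pred-cancel = solve-∀

+∣-∣ : ∀ {x y} → x ≤ y → + ∣ y - x ∣ ≡ y - x
+∣-∣ x≤y = ZP.0≤i⇒+∣i∣≡i (ZP.i≤j⇒0≤j-i x≤y)

-- The abacus of a charged partition

-- Row r (counted from 0) with part p carries the bead p − (r + 1) + c, i.e. λᵢ − i + c;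
-- emptyBead c r is the bead of row r when that row is empty.
emptyBead : ℤ → ℕ → ℤ
emptyBead c r = c - + suc r

beadsFrom : ℤ → ℕ → List ℕ → List ℤ
beadsFrom c r []       = []
beadsFrom c r (p ∷ ps) = emptyBead c r + + p ∷ beadsFrom c (suc r) ps

padTo : ℕ → List ℕ → List ℕ
padTo N ps = ps ++ replicate (N ∸ length ps) 0

beads : ℤ → List ℕ → ℕ → List ℤ
beads c ps N = beadsFrom c 0 (padTo N ps)

-- The full abacus of the rows ps placed from row r on: their beads, and every
-- position at or below the bead of the first empty row.
IsBead : ℤ → ℕ → List ℕ → ℤ → Set
IsBead c r ps z = z ∈ beadsFrom c r ps ⊎ z ≤ emptyBead c (length ps +ℕ r)

isBead? : ∀ c r ps z → Dec (IsBead c r ps z)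
isBead? c r ps z = (z ∈? beadsFrom c r ps) ⊎-dec (z ZP.≤? emptyBead c (length ps +ℕ r))

emptyBead-anti-< : ∀ c {r r′} → r <ℕ r′ → emptyBead c r′ < emptyBead c r
emptyBead-anti-< c r<r′ = ZP.+-monoʳ-< c (ZP.neg-mono-< (+<+ (s≤s r<r′)))

emptyBead-anti-≤ : ∀ c {r n} → suc r ≤ℕ n → c - + n ≤ emptyBead c r
emptyBead-anti-≤ c r<n = ZP.+-monoʳ-≤ c (ZP.neg-mono-≤ (+≤+ r<n))

length-beadsFrom : ∀ c r ps → length (beadsFrom c r ps) ≡ length ps
length-beadsFrom c r []       = refl
length-beadsFrom c r (p ∷ ps) = cong suc (length-beadsFrom c (suc r) ps)

length-padTo : ∀ {N} ps → length ps ≤ℕ N → length (padTo N ps) ≡ N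
length-padTo {N} ps ps≤N = begin
  length (ps ++ replicate (N ∸ length ps) 0)  ≡⟨ LP.length-++ ps ⟩
  length ps +ℕ length (replicate (N ∸ length ps) 0)  ≡⟨ cong (length ps +ℕ_) (LP.length-replicate (N ∸ length ps)) ⟩
  length ps +ℕ (N ∸ length ps)  ≡⟨ NP.m+[n∸m]≡n ps≤N ⟩
  N  ∎
  where open ≡-Reasoning

length-beads : ∀ c ps {N} → length ps ≤ℕ N → length (beads c ps N) ≡ N
length-beads c ps ps≤N = trans (length-beadsFrom c 0 (padTo _ ps)) (length-padTo ps ps≤N)

beadsFrom-below : ∀ c {r p} qs {r′} → r <ℕ r′ → All (_≤ℕ p) qs → All (_< emptyBead c r + + p) (beadsFrom c r′ qs)
beadsFrom-below c []       r<r′ []          = []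
beadsFrom-below c (q ∷ qs) r<r′ (q≤p ∷ qs≤p) =
  ZP.+-mono-<-≤ (emptyBead-anti-< c r<r′) (+≤+ q≤p) ∷ beadsFrom-below c qs (NP.m≤n⇒m≤1+n r<r′) qs≤p

beadsFrom-strict : ∀ c r {ps} → AllPairs _≥ℕ_ ps → AllPairs _>_ (beadsFrom c r ps)
beadsFrom-strict c r {[]}     []              = []
beadsFrom-strict c r {p ∷ ps} (ps≤p ∷ ps-dec) =
  beadsFrom-below c ps (NP.n<1+n r) ps≤p ∷ beadsFrom-strict c (suc r) ps-dec

strict⇒Unique : ∀ {xs} → AllPairs _>_ xs → Unique xs
strict⇒Unique = AllPairs.map (λ x>y x≡y → ZP.<-irrefl (sym x≡y) x>y)

beadsFrom-++ : ∀ c r ps qs → beadsFrom c r (ps ++ qs) ≡ beadsFrom c r ps ++ beadsFrom c (length ps +ℕ r) qs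
beadsFrom-++ c r []       qs = refl
beadsFrom-++ c r (p ∷ ps) qs =
  cong (emptyBead c r + + p ∷_)
    (trans (beadsFrom-++ c (suc r) ps qs) (cong (λ s → beadsFrom c (suc r) ps ++ beadsFrom c s qs) (NP.+-suc (length ps) r)))

beadsFrom-emptyRows : ∀ c r K → All (_≤ emptyBead c r) (beadsFrom c r (replicate K 0))
beadsFrom-emptyRows c r zero    = []
beadsFrom-emptyRows c r (suc K) =
  ZP.≤-reflexive (ZP.+-identityʳ (emptyBead c r))
  ∷ All.map (λ b≤ → ZP.≤-trans b≤ (ZP.<⇒≤ (emptyBead-anti-< c (NP.n<1+n r)))) (beadsFrom-emptyRows c (suc r) K)

beadsFrom-floor : ∀ c r qs {n} → length qs +ℕ r ≤ℕ n → All (c - + n ≤_) (beadsFrom c r qs)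
beadsFrom-floor c r []       _ = []
beadsFrom-floor c r (q ∷ qs) {n} qs+r≤n =
  ZP.≤-trans (emptyBead-anti-≤ c (NP.≤-trans (s≤s (NP.m≤n+m r (length qs))) qs+r≤n)) (ZP.i≤i+j (emptyBead c r) (+ q))
  ∷ beadsFrom-floor c (suc r) qs (subst (_≤ℕ n) (sym (NP.+-suc (length qs) r)) qs+r≤n)

beads-floor : ∀ c ps {N} → length ps ≤ℕ N → All (c - + N ≤_) (beads c ps N)
beads-floor c ps {N} ps≤N = beadsFrom-floor c 0 (padTo N ps) (NP.≤-reflexive (trans (NP.+-identityʳ _) (length-padTo ps ps≤N)))

beadsFrom-recharge : ∀ c d r ps → beadsFrom (c + d) r ps ≡ map (_+ d) (beadsFrom c r ps)
beadsFrom-recharge c d r []       = refl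
beadsFrom-recharge c d r (p ∷ ps) = cong₂ _∷_ (recharged c d (+ r) (+ p)) (beadsFrom-recharge c d (suc r) ps)
  where
  recharged : ∀ c d r p → (c + d) - (+ 1 + r) + p ≡ ((c - (+ 1 + r)) + p) + d
  recharged = solve-∀

beads-recharge : ∀ c c′ ps N {z} → z ∈ beads c ps N → z + (c′ - c) ∈ beads c′ ps N
beads-recharge c c′ ps N {z} z∈ =
  subst (λ c″ → z + (c′ - c) ∈ beads c″ ps N) (c+[c′-c]≡c′ c c′)
    (subst (z + (c′ - c) ∈_) (sym (beadsFrom-recharge c (c′ - c) 0 (padTo N ps))) (∈-map⁺ (_+ (c′ - c)) z∈))
  where
  c+[c′-c]≡c′ : ∀ c c′ → c + (c′ - c) ≡ c′
  c+[c′-c]≡c′ = solve-∀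

beadsFrom⊆beads : ∀ c ps N {z} → z ∈ beadsFrom c 0 ps → z ∈ beads c ps N
beadsFrom⊆beads c ps N {z} z∈ = subst (z ∈_) (sym (beadsFrom-++ c 0 ps _)) (∈-++⁺ˡ z∈)

beads⇒IsBead : ∀ c ps N {z} → z ∈ beads c ps N → IsBead c 0 ps z
beads⇒IsBead c ps N {z} z∈ with ∈-++⁻ (beadsFrom c 0 ps) (subst (z ∈_) (beadsFrom-++ c 0 ps _) z∈)
... | inj₁ z∈ps  = inj₁ z∈ps
... | inj₂ z∈pad = inj₂ (All.lookup (beadsFrom-emptyRows c (length ps +ℕ 0) (N ∸ length ps)) z∈pad)

IsBead-∷ : ∀ {c r p ps z} → IsBead c r (p ∷ ps) z → z ≡ emptyBead c r + + p ⊎ IsBead c (suc r) ps z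
IsBead-∷ (inj₁ (here z≡))   = inj₁ z≡
IsBead-∷ (inj₁ (there z∈))  = inj₂ (inj₁ z∈)
IsBead-∷ {c} {r} {p} {ps} {z} (inj₂ z≤) = inj₂ (inj₂ (subst (λ s → z ≤ emptyBead c s) (sym (NP.+-suc (length ps) r)) z≤))

zeros-decreasing : ∀ K → Linked _≥ℕ_ (replicate K 0)
zeros-decreasing zero          = []
zeros-decreasing (suc zero)    = [-]
zeros-decreasing (suc (suc K)) = z≤n ∷ zeros-decreasing (suc K)

padTo-decreasing : ∀ N {ps} → Linked _≥ℕ_ ps → Linked _≥ℕ_ (padTo N ps)
padTo-decreasing N {ps} = go (N ∸ length ps)
  where
  go : ∀ K {ps} → Linked _≥ℕ_ ps → Linked _≥ℕ_ (ps ++ replicate K 0)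
  go K       []          = zeros-decreasing K
  go zero    [-]         = [-]
  go (suc K) [-]         = z≤n ∷ zeros-decreasing (suc K)
  go K       (p≥q ∷ dec) = p≥q ∷ go K dec

decreasing⇒AllPairs : ∀ {ps} → Linked _≥ℕ_ ps → AllPairs _≥ℕ_ ps
decreasing⇒AllPairs = Linked⇒AllPairs (λ p≥q q≥r → NP.≤-trans q≥r p≥q)

parts-decreasing : (ν : Partition) → AllPairs _≥ℕ_ (parts ν)
parts-decreasing ν = decreasing⇒AllPairs (decreasing ν)

beadsFrom-unique : ∀ c (ν : Partition) → Unique (beadsFrom c 0 (parts ν))
beadsFrom-unique c ν = strict⇒Unique (beadsFrom-strict c 0 (parts-decreasing ν))

beads-unique : ∀ c (ν : Partition) N → Unique (beads c (parts ν) N)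
beads-unique c ν N = strict⇒Unique (beadsFrom-strict c 0 (decreasing⇒AllPairs (padTo-decreasing N (decreasing ν))))

-- Content in terms of beads

𝟙-≤-suc : ∀ t u → 𝟙 (t ZP.≟ u + + 1) +ℕ 𝟙 (t ZP.≤? u) ≡ 𝟙 (t ZP.≤? u + + 1)
𝟙-≤-suc t u with t ZP.≟ u + + 1 | t ZP.≤? u | t ZP.≤? u + + 1
... | yes refl | yes t≤u   | _          = ⊥-elim (ZP.<⇒≱ (ZP.suc[i]≤j⇒i<j (ZP.≤-reflexive (ZP.+-comm (+ 1) u))) t≤u)
... | yes _    | no _      | yes _      = refl
... | yes refl | no _      | no t≰t     = ⊥-elim (t≰t ZP.≤-refl)
... | no _     | yes _     | yes _      = refl
... | no _     | yes t≤u   | no t≰u+1   = ⊥-elim (t≰u+1 (ZP.≤-trans t≤u (ZP.i≤i+j u (+ 1))))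
... | no t≢u+1 | no t≰u    | yes t≤u+1  = ⊥-elim (t≰u (<1+⇒≤ (ZP.≤∧≢⇒< t≤u+1 t≢u+1)))
... | no _     | no _      | no _       = refl

open Multiplicity ZP._≟_

multiplicity-interval : ∀ t u f p → (∀ k → f k ≡ u + + suc k) →
  multiplicity t (applyUpTo f p) +ℕ 𝟙 (t ZP.≤? u) ≡ 𝟙 (t ZP.≤? u + + p)
multiplicity-interval t u f zero    _  = cong (λ v → 𝟙 (t ZP.≤? v)) (sym (ZP.+-identityʳ u))
multiplicity-interval t u f (suc p) f≡ = begin
  multiplicity t (f 0 ∷ rest) +ℕ 𝟙 (t ZP.≤? u)
    ≡⟨ cong (_+ℕ 𝟙 (t ZP.≤? u)) (count-∷ (t ZP.≟_) (f 0) rest) ⟩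
  (𝟙 (t ZP.≟ f 0) +ℕ multiplicity t rest) +ℕ 𝟙 (t ZP.≤? u)
    ≡⟨ cong (λ v → (𝟙 (t ZP.≟ v) +ℕ multiplicity t rest) +ℕ 𝟙 (t ZP.≤? u)) (f≡ 0) ⟩
  (𝟙 (t ZP.≟ u + + 1) +ℕ multiplicity t rest) +ℕ 𝟙 (t ZP.≤? u)
    ≡⟨ rearrange (𝟙 (t ZP.≟ u + + 1)) (multiplicity t rest) (𝟙 (t ZP.≤? u)) ⟩
  multiplicity t rest +ℕ (𝟙 (t ZP.≟ u + + 1) +ℕ 𝟙 (t ZP.≤? u))
    ≡⟨ cong (multiplicity t rest +ℕ_) (𝟙-≤-suc t u) ⟩
  multiplicity t rest +ℕ 𝟙 (t ZP.≤? u + + 1)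
    ≡⟨ multiplicity-interval t (u + + 1) (λ k → f (suc k)) p (λ k → trans (f≡ (suc k)) (sym (ZP.+-assoc u (+ 1) (+ suc k)))) ⟩
  𝟙 (t ZP.≤? (u + + 1) + + p)
    ≡⟨ cong (λ v → 𝟙 (t ZP.≤? v)) (ZP.+-assoc u (+ 1) (+ p)) ⟩
  𝟙 (t ZP.≤? u + + suc p) ∎
  where
  open ≡-Reasoning
  rest = applyUpTo (λ k → f (suc k)) p
  rearrange : ∀ a b c → (a +ℕ b) +ℕ c ≡ b +ℕ (a +ℕ c)
  rearrange = ℕ-Solver.solve-∀

countAtLeast : ℤ → List ℤ → ℕ
countAtLeast t = count (t ZP.≤?_)

multiplicity-residuesFrom : ∀ c r ps t →
  multiplicity t (residuesFrom c r ps) +ℕ countAtLeast t (beadsFrom c r (replicate (length ps) 0))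
    ≡ countAtLeast t (beadsFrom c r ps)
multiplicity-residuesFrom c r []       t = refl
multiplicity-residuesFrom c r (p ∷ ps) t = begin
  multiplicity t (row ++ rest) +ℕ countAtLeast t (e + + 0 ∷ restEmpty)
    ≡⟨ cong₂ _+ℕ_ (count-++ (t ZP.≟_) row rest) (count-∷ (t ZP.≤?_) (e + + 0) restEmpty) ⟩
  (multiplicity t row +ℕ multiplicity t rest) +ℕ (𝟙 (t ZP.≤? e + + 0) +ℕ countAtLeast t restEmpty)
    ≡⟨ interchange (multiplicity t row) (multiplicity t rest) (𝟙 (t ZP.≤? e + + 0)) (countAtLeast t restEmpty) ⟩
  (multiplicity t row +ℕ 𝟙 (t ZP.≤? e + + 0)) +ℕ (multiplicity t rest +ℕ countAtLeast t restEmpty)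
    ≡⟨ cong₂ _+ℕ_ rowCount (multiplicity-residuesFrom c (suc r) ps t) ⟩
  𝟙 (t ZP.≤? e + + p) +ℕ countAtLeast t (beadsFrom c (suc r) ps)
    ≡⟨ sym (count-∷ (t ZP.≤?_) (e + + p) (beadsFrom c (suc r) ps)) ⟩
  countAtLeast t (beadsFrom c r (p ∷ ps)) ∎
  where
  open ≡-Reasoning
  e = emptyBead c r
  row = map (λ k → (c + + k) - + r) (upTo p)
  rest = residuesFrom c (suc r) ps
  restEmpty = beadsFrom c (suc r) (replicate (length ps) 0)
  interchange : ∀ a b c d → (a +ℕ b) +ℕ (c +ℕ d) ≡ (a +ℕ c) +ℕ (b +ℕ d)
  interchange = ℕ-Solver.solve-∀
  residue≡ : ∀ c k r → (c + k) - r ≡ (c - (+ 1 + r)) + (+ 1 + k)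
  residue≡ = solve-∀
  rowCount : multiplicity t row +ℕ 𝟙 (t ZP.≤? e + + 0) ≡ 𝟙 (t ZP.≤? e + + p)
  rowCount = begin
    multiplicity t row +ℕ 𝟙 (t ZP.≤? e + + 0)
      ≡⟨ cong₂ (λ xs v → multiplicity t xs +ℕ 𝟙 (t ZP.≤? v)) (LP.map-upTo _ p) (ZP.+-identityʳ e) ⟩
    multiplicity t (applyUpTo (λ k → (c + + k) - + r) p) +ℕ 𝟙 (t ZP.≤? e)
      ≡⟨ multiplicity-interval t e _ p (λ k → residue≡ c (+ k) (+ r)) ⟩
    𝟙 (t ZP.≤? e + + p) ∎

residuesFrom-emptyRows : ∀ c r K → residuesFrom c r (replicate K 0) ≡ []
residuesFrom-emptyRows c r zero    = refl
residuesFrom-emptyRows c r (suc K) = residuesFrom-emptyRows c (suc r) K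

residuesFrom-padded : ∀ c r ps K → residuesFrom c r (ps ++ replicate K 0) ≡ residuesFrom c r ps
residuesFrom-padded c r []       K = residuesFrom-emptyRows c r K
residuesFrom-padded c r (p ∷ ps) K = cong (map (λ k → (c + + k) - + r) (upTo p) ++_) (residuesFrom-padded c (suc r) ps K)

multiplicity-residues : ∀ c ps {N} t → length ps ≤ℕ N →
  multiplicity t (residuesFrom c 0 ps) +ℕ countAtLeast t (beads c [] N) ≡ countAtLeast t (beads c ps N)
multiplicity-residues c ps {N} t ps≤N = begin
  multiplicity t (residuesFrom c 0 ps) +ℕ countAtLeast t (beadsFrom c 0 (replicate N 0))
    ≡⟨ cong₂ (λ xs n → multiplicity t xs +ℕ countAtLeast t (beadsFrom c 0 (replicate n 0)))
             (sym (residuesFrom-padded c 0 ps (N ∸ length ps))) (sym (length-padTo ps ps≤N)) ⟩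
  multiplicity t (residuesFrom c 0 (padTo N ps)) +ℕ countAtLeast t (beadsFrom c 0 (replicate (length (padTo N ps)) 0))
    ≡⟨ multiplicity-residuesFrom c 0 (padTo N ps) t ⟩
  countAtLeast t (beads c ps N) ∎
  where open ≡-Reasoning

multiplicity-content : ∀ c₁ c₂ (λ₁ λ₂ : Partition) {N₁ N₂} t →
  length (parts λ₁) ≤ℕ N₁ → length (parts λ₂) ≤ℕ N₂ →
  multiplicity t (content (c₁ , c₂) (λ₁ , λ₂)) +ℕ countAtLeast t (beads c₁ [] N₁ ++ beads c₂ [] N₂)
    ≡ countAtLeast t (beads c₁ (parts λ₁) N₁ ++ beads c₂ (parts λ₂) N₂)
multiplicity-content c₁ c₂ λ₁ λ₂ {N₁} {N₂} t λ₁≤N₁ λ₂≤N₂ = begin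
  multiplicity t (res₁ ++ res₂) +ℕ countAtLeast t (beads c₁ [] N₁ ++ beads c₂ [] N₂)
    ≡⟨ cong₂ _+ℕ_ (count-++ (t ZP.≟_) res₁ res₂) (count-++ (t ZP.≤?_) (beads c₁ [] N₁) (beads c₂ [] N₂)) ⟩
  (multiplicity t res₁ +ℕ multiplicity t res₂) +ℕ (countAtLeast t (beads c₁ [] N₁) +ℕ countAtLeast t (beads c₂ [] N₂))
    ≡⟨ interchange (multiplicity t res₁) (multiplicity t res₂) _ _ ⟩
  (multiplicity t res₁ +ℕ countAtLeast t (beads c₁ [] N₁)) +ℕ (multiplicity t res₂ +ℕ countAtLeast t (beads c₂ [] N₂))
    ≡⟨ cong₂ _+ℕ_ (multiplicity-residues c₁ (parts λ₁) t λ₁≤N₁) (multiplicity-residues c₂ (parts λ₂) t λ₂≤N₂) ⟩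
  countAtLeast t (beads c₁ (parts λ₁) N₁) +ℕ countAtLeast t (beads c₂ (parts λ₂) N₂)
    ≡⟨ sym (count-++ (t ZP.≤?_) (beads c₁ (parts λ₁) N₁) (beads c₂ (parts λ₂) N₂)) ⟩
  countAtLeast t (beads c₁ (parts λ₁) N₁ ++ beads c₂ (parts λ₂) N₂) ∎
  where
  open ≡-Reasoning
  res₁ = residues c₁ λ₁
  res₂ = residues c₂ λ₂
  interchange : ∀ a b c d → (a +ℕ b) +ℕ (c +ℕ d) ≡ (a +ℕ c) +ℕ (b +ℕ d)
  interchange = ℕ-Solver.solve-∀

beads-↭⇒content-↭ : ∀ c₁ c₂ (μ₁ μ₂ λ₁ λ₂ : Partition) {N₁ N₂} →
  length (parts μ₁) ≤ℕ N₁ → length (parts μ₂) ≤ℕ N₂ →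
  length (parts λ₁) ≤ℕ N₁ → length (parts λ₂) ≤ℕ N₂ →
  beads c₁ (parts μ₁) N₁ ++ beads c₂ (parts μ₂) N₂ ↭ beads c₁ (parts λ₁) N₁ ++ beads c₂ (parts λ₂) N₂ →
  content (c₁ , c₂) (μ₁ , μ₂) ↭ content (c₁ , c₂) (λ₁ , λ₂)
beads-↭⇒content-↭ c₁ c₂ μ₁ μ₂ λ₁ λ₂ μ₁≤ μ₂≤ λ₁≤ λ₂≤ beads↭ = multiplicity-≡⇒↭ _ _ λ t →
  NP.+-cancelʳ-≡ _ _ _ (trans (multiplicity-content c₁ c₂ μ₁ μ₂ t μ₁≤ μ₂≤)
                      (trans (count-↭ (t ZP.≤?_) beads↭) (sym (multiplicity-content c₁ c₂ λ₁ λ₂ t λ₁≤ λ₂≤))))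

descending : ∀ {xs} → Linked _≥_ xs → Unique xs → Linked _>_ xs
descending []             _                  = []
descending [-]            _                  = [-]
descending (x≥y ∷ y≥zs) ((x≢y ∷ _) ∷ uniq) = ZP.≤∧≢⇒< x≥y (λ y≡x → x≢y (sym y≡x)) ∷ descending y≥zs uniq

sort-descending : ∀ xs → Unique xs → Linked _>_ (sort xs)
sort-descending xs uniq =
  descending (sort-↗ xs) (PermutationSetoid.Unique-resp-↭ (setoid ℤ) (↭⇒↭ₛ (↭-sym (sort-↭ xs))) uniq)

rowLengths : ℤ → ℕ → List ℤ → List ℕ
rowLengths c r []       = []
rowLengths c r (b ∷ bs) = ∣ b - emptyBead c r ∣ ∷ rowLengths c (suc r) bs

AboveEmptyBeads : ℤ → ℕ → List ℤ → Set
AboveEmptyBeads c r []       = ⊤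
AboveEmptyBeads c r (b ∷ bs) = emptyBead c r ≤ b × AboveEmptyBeads c (suc r) bs

length-rowLengths : ∀ c r bs → length (rowLengths c r bs) ≡ length bs
length-rowLengths c r []       = refl
length-rowLengths c r (b ∷ bs) = cong suc (length-rowLengths c (suc r) bs)

beadsFrom-rowLengths : ∀ c r bs → AboveEmptyBeads c r bs → beadsFrom c r (rowLengths c r bs) ≡ bs
beadsFrom-rowLengths c r []       _          = refl
beadsFrom-rowLengths c r (b ∷ bs) (e≤b , above) =
  cong₂ _∷_ (trans (cong (λ d → emptyBead c r + d) (+∣-∣ e≤b)) (x+[y-x]≡y (emptyBead c r) b))
            (beadsFrom-rowLengths c (suc r) bs above)
  where
  x+[y-x]≡y : ∀ x y → x + (y - x) ≡ y
  x+[y-x]≡y = solve-∀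

rowLengths-decreasing : ∀ c r {bs} → Linked _>_ bs → AboveEmptyBeads c r bs → Linked _≥ℕ_ (rowLengths c r bs)
rowLengths-decreasing c r []  _ = []
rowLengths-decreasing c r [-] _ = [-]
rowLengths-decreasing c r {b ∷ b′ ∷ bs} (b>b′ ∷ desc) (e≤b , e′≤b′ , above) =
  ZP.drop‿+≤+ (subst₂ _≤_ (sym (+∣-∣ e′≤b′)) (sym (+∣-∣ e≤b)) step)
  ∷ rowLengths-decreasing c (suc r) desc (e′≤b′ , above)
  where
  next-row : ∀ b c r → b - (c - (+ 1 + (+ 1 + r))) ≡ (+ 1 + b) - (c - (+ 1 + r))
  next-row = solve-∀
  step : b′ - emptyBead c (suc r) ≤ b - emptyBead c r
  step = subst (_≤ b - emptyBead c r) (sym (next-row b′ c (+ r))) (ZP.+-monoˡ-≤ _ (ZP.i<j⇒suc[i]≤j b>b′))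

stripZeros : List ℕ → List ℕ
stripZeros []           = []
stripZeros (zero ∷ _)   = []
stripZeros (suc p ∷ ps) = suc p ∷ stripZeros ps

stripZeros-decreasing : ∀ {ps} → Linked _≥ℕ_ ps → Linked _≥ℕ_ (stripZeros ps)
stripZeros-decreasing {[]}                    _          = []
stripZeros-decreasing {zero ∷ _}              _          = []
stripZeros-decreasing {suc p ∷ []}            _          = [-]
stripZeros-decreasing {suc p ∷ zero ∷ _}      _          = [-]
stripZeros-decreasing {suc p ∷ suc q ∷ _}     (p≥q ∷ ps) = p≥q ∷ stripZeros-decreasing ps

stripZeros-positive : ∀ ps → All (_≥ℕ 1) (stripZeros ps)
stripZeros-positive []           = []
stripZeros-positive (zero ∷ _)   = []
stripZeros-positive (suc p ∷ ps) = s≤s z≤n ∷ stripZeros-positive ps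

length-stripZeros : ∀ ps → length (stripZeros ps) ≤ℕ length ps
length-stripZeros []           = z≤n
length-stripZeros (zero ∷ _)   = z≤n
length-stripZeros (suc p ∷ ps) = s≤s (length-stripZeros ps)

decreasing-from-0 : ∀ {ps} → Linked _≥ℕ_ (0 ∷ ps) → ps ≡ replicate (length ps) 0
decreasing-from-0 {[]}       _           = refl
decreasing-from-0 {zero ∷ _} (_ ∷ zeros) = cong (0 ∷_) (decreasing-from-0 zeros)

padTo-stripZeros : ∀ {ps} → Linked _≥ℕ_ ps → padTo (length ps) (stripZeros ps) ≡ ps
padTo-stripZeros {[]}         _   = refl
padTo-stripZeros {zero ∷ _}   dec = cong (0 ∷_) (sym (decreasing-from-0 dec))
padTo-stripZeros {suc p ∷ _}  dec = cong (suc p ∷_) (padTo-stripZeros (Linked.tail dec))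

partitionOfBeads : ∀ c {bs} → Linked _>_ bs → AboveEmptyBeads c 0 bs → Partition
partitionOfBeads c {bs} desc above =
  mkPartition (stripZeros (rowLengths c 0 bs)) (stripZeros-decreasing (rowLengths-decreasing c 0 desc above)) (stripZeros-positive _)

length-partitionOfBeads : ∀ c {bs} desc above → length (parts (partitionOfBeads c {bs} desc above)) ≤ℕ length bs
length-partitionOfBeads c {bs} _ _ =
  subst (length (stripZeros (rowLengths c 0 bs)) ≤ℕ_) (length-rowLengths c 0 bs) (length-stripZeros (rowLengths c 0 bs))

beads-partitionOfBeads : ∀ c {bs} desc above → beads c (parts (partitionOfBeads c {bs} desc above)) (length bs) ≡ bs
beads-partitionOfBeads c {bs} desc above = begin
  beadsFrom c 0 (padTo (length bs) (stripZeros rows))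
    ≡⟨ cong (λ n → beadsFrom c 0 (padTo n (stripZeros rows))) (sym (length-rowLengths c 0 bs)) ⟩
  beadsFrom c 0 (padTo (length rows) (stripZeros rows))
    ≡⟨ cong (beadsFrom c 0) (padTo-stripZeros (rowLengths-decreasing c 0 desc above)) ⟩
  beadsFrom c 0 rows
    ≡⟨ beadsFrom-rowLengths c 0 bs above ⟩
  bs ∎
  where
  rows = rowLengths c 0 bs
  open ≡-Reasoning

descending-head≥ : ∀ {F b bs} → Linked _>_ (b ∷ bs) → All (F ≤_) (b ∷ bs) → F + + length bs ≤ b
descending-head≥ {F} {b} [-]                    (F≤b ∷ []) = subst (_≤ b) (sym (ZP.+-identityʳ F)) F≤b
descending-head≥ {F} {b} {_ ∷ bs} (b>b′ ∷ desc) (_ ∷ F≤bs) =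
  subst (_≤ b) (sym (suc-inside F (+ length bs))) (ZP.i<j⇒suc[i]≤j (ZP.≤-<-trans (descending-head≥ desc F≤bs) b>b′))
  where
  suc-inside : ∀ F l → F + (+ 1 + l) ≡ + 1 + (F + l)
  suc-inside = solve-∀

floor⇒AboveEmptyBeads : ∀ c r {bs} → Linked _>_ bs → All (c - + (length bs +ℕ r) ≤_) bs → AboveEmptyBeads c r bs
floor⇒AboveEmptyBeads c r {[]}     _    _            = tt
floor⇒AboveEmptyBeads c r {b ∷ bs} desc (F≤b ∷ F≤bs) =
  subst (_≤ b) (floor+length c (+ length bs) (+ r)) (descending-head≥ desc (F≤b ∷ F≤bs)) ,
  floor⇒AboveEmptyBeads c (suc r) (Linked.tail desc) (subst (λ n → All (c - + n ≤_) bs) (sym (NP.+-suc (length bs) r)) F≤bs)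
  where
  floor+length : ∀ c l r → (c - ((+ 1 + l) + r)) + l ≡ c - (+ 1 + r)
  floor+length = solve-∀

beadList⇒partition : ∀ c {N} bs → length bs ≡ N → Unique bs → All (c - + N ≤_) bs →
  Σ Partition λ μ → length (parts μ) ≤ℕ N × beads c (parts μ) N ↭ bs
beadList⇒partition c bs refl uniq floor =
  μ , subst (length (parts μ) ≤ℕ_) length≡ (length-partitionOfBeads c desc above) ,
  ↭-trans (↭-reflexive (subst (λ n → beads c (parts μ) n ≡ sort bs) length≡ (beads-partitionOfBeads c desc above)))
          (sort-↭ bs)
  where
  length≡ : length (sort bs) ≡ length bs
  length≡ = ↭-length (sort-↭ bs)
  desc = sort-descending bs uniq
  above : AboveEmptyBeads c 0 (sort bs)
  above = floor⇒AboveEmptyBeads c 0 desc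
    (subst (λ n → All (c - + n ≤_) (sort bs)) (sym (trans (NP.+-identityʳ _) length≡)) (All-resp-↭ (↭-sym (sort-↭ bs)) floor))
  μ = partitionOfBeads c desc above

moveBead : ∀ c (ν : Partition) {N x xs y} → length (parts ν) ≤ℕ N →
  beads c (parts ν) N ↭ x ∷ xs → y ∉ beads c (parts ν) N → c - + N ≤ y →
  Σ Partition λ μ → length (parts μ) ≤ℕ N × beads c (parts μ) N ↭ y ∷ xs
moveBead c ν {N} ν≤N B↭ y∉B floor≤y =
  beadList⇒partition c _ (trans (sym (↭-length B↭)) (length-beads c (parts ν) ν≤N))
    (Unique-replaceHead B↭ (beads-unique c ν N) y∉B) (All-replaceHead B↭ (beads-floor c (parts ν) ν≤N) floor≤y)

-- Cores

module _ (c : ℤ) (k : ℕ) (λ₁ λ₂ : Partition) (core : IsCore (c + + k , c) (λ₁ , λ₂))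
         {N : ℕ} (λ₁≤ : length (parts λ₁) ≤ℕ N +ℕ k) (λ₂≤ : length (parts λ₂) ≤ℕ N) where

  private
    B₁ = beads (c + + k) (parts λ₁) (N +ℕ k)
    B₂ = beads c (parts λ₂) N

    floor≡ : (c + + k) - + (N +ℕ k) ≡ c - + N
    floor≡ = cancel c (+ N) (+ k)
      where
      cancel : ∀ c n k → (c + k) - (n + k) ≡ c - n
      cancel = solve-∀

    floor₁ : ∀ {z} → z ∈ B₁ → c - + N ≤ z
    floor₁ z∈B₁ = subst (_≤ _) floor≡ (All.lookup (beads-floor (c + + k) (parts λ₁) λ₁≤) z∈B₁)

    floor₂ : ∀ {z} → z ∈ B₂ → c - + N ≤ z
    floor₂ = All.lookup (beads-floor c (parts λ₂) λ₂≤)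

  -- Swapping z and z′ between the two abaci keeps their multiset union, hence the content.
  core-exchange : ∀ {z z′} → z ∈ B₂ → z ∉ B₁ → z′ ∈ B₁ → z′ ∉ B₂ → ⊥
  core-exchange {z} {z′} z∈B₂ z∉B₁ z′∈B₁ z′∉B₂
    with zs₁ , B₁↭ ← ∈⇒↭∷ z′∈B₁ | zs₂ , B₂↭ ← ∈⇒↭∷ z∈B₂
    with μ₁ , μ₁≤ , μ₁↭ ← moveBead (c + + k) λ₁ λ₁≤ B₁↭ z∉B₁ (subst (_≤ z) (sym floor≡) (floor₂ z∈B₂))
       | μ₂ , μ₂≤ , μ₂↭ ← moveBead c λ₂ λ₂≤ B₂↭ z′∉B₂ (floor₁ z′∈B₁)
    = z∉B₁ (subst (λ ps → z ∈ beads (c + + k) ps (N +ℕ k)) (proj₁ same) (∈-resp-↭ (↭-sym μ₁↭) (here refl)))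
    where
    exchanged : beads (c + + k) (parts μ₁) (N +ℕ k) ++ beads c (parts μ₂) N ↭ B₁ ++ B₂
    exchanged = ↭-trans (++⁺ μ₁↭ μ₂↭) (↭-trans (↭-exchange z′ z zs₁ zs₂) (↭-sym (++⁺ B₁↭ B₂↭)))
    same : SameBipartition (μ₁ , μ₂) (λ₁ , λ₂)
    same = core (μ₁ , μ₂) (beads-↭⇒content-↭ (c + + k) c μ₁ μ₂ λ₁ λ₂ μ₁≤ μ₂≤ λ₁≤ λ₂≤ exchanged)

  core⇒beads⊆ : ∀ {z} → z ∈ B₂ → z ∈ B₁
  core⇒beads⊆ {z} z∈B₂ with z ∈? B₁
  ... | yes z∈B₁ = z∈B₁
  ... | no z∉B₁ with all? (_∈? B₂) B₁
  ...   | yes B₁⊆B₂ = ⊥-elim (NP.m+n≮n k N (subst (_≤ℕ N) (cong suc (NP.+-comm N k)) tooMany))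
    where
    tooMany : suc (N +ℕ k) ≤ℕ N
    tooMany = subst₂ _≤ℕ_ (cong suc (length-beads (c + + k) (parts λ₁) λ₁≤)) (length-beads c (parts λ₂) λ₂≤)
      (Unique-⊆⇒length-≤ (∉⇒Unique-∷ z∉B₁ (beads-unique (c + + k) λ₁ (N +ℕ k))) λ where
        (here refl) → z∈B₂
        (there w∈B₁) → All.lookup B₁⊆B₂ w∈B₁)
  ...   | no B₁⊈B₂ with z′ , z′∈B₁ , z′∉B₂ ← find (¬All⇒Any¬ (_∈? B₂) B₁ B₁⊈B₂) =
    ⊥-elim (core-exchange z∈B₂ z∉B₁ z′∈B₁ z′∉B₂)

  extra-beads≤ : ∀ {ws} → Unique ws → (∀ {w} → w ∈ ws → w ∈ B₁) → (∀ {w} → w ∈ ws → w ∉ B₂) → length ws ≤ℕ k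
  extra-beads≤ {ws} uniq ws⊆B₁ ws∩B₂=∅ =
    NP.+-cancelˡ-≤ N (length ws) k (subst₂ _≤ℕ_ lengths≡ (length-beads (c + + k) (parts λ₁) λ₁≤)
      (disjoint-⊆⇒length-≤ uniq (beads-unique c λ₂ N) (λ (w∈ws , w∈B₂) → ws∩B₂=∅ w∈ws w∈B₂) ws⊆B₁ core⇒beads⊆))
    where
    lengths≡ : length ws +ℕ length B₂ ≡ N +ℕ length ws
    lengths≡ = trans (cong (length ws +ℕ_) (length-beads c (parts λ₂) λ₂≤)) (NP.+-comm (length ws) N)

-- Hooks and gaps

leg : List ℕ → ℕ → ℕ
leg qs j = length (filter (j ≤ℕ?_) qs)

hook : ℕ → List ℕ → ℕ → ℕ
hook p qs j = suc ((p ∸ j) +ℕ leg qs j)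

above⇒¬IsBead : ∀ c r {qs B z} → All (_≤ℕ B) qs → emptyBead c r + + B < z → ¬ IsBead c r qs z
above⇒¬IsBead c r {[]}     []        e+B<z (inj₂ z≤e) = ZP.<⇒≱ e+B<z (ZP.≤-trans z≤e (ZP.i≤i+j _ _))
above⇒¬IsBead c r {q ∷ qs} (q≤B ∷ _) e+B<z isBead with IsBead-∷ isBead
above⇒¬IsBead c r          (q≤B ∷ _) e+B<z _ | inj₁ refl =
  ZP.<⇒≱ e+B<z (ZP.+-monoʳ-≤ (emptyBead c r) (+≤+ q≤B))
above⇒¬IsBead c r          (_ ∷ qs≤B) e+B<z _ | inj₂ isBead′ =
  above⇒¬IsBead c (suc r) qs≤B (ZP.<-trans (ZP.+-monoˡ-< _ (emptyBead-anti-< c (NP.n<1+n r))) e+B<z) isBead′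

leg-gap : ∀ c r {qs} j → AllPairs _≥ℕ_ qs → 1 ≤ℕ j → ¬ IsBead c r qs ((emptyBead c r + + j) - + leg qs j)
leg-gap c r {[]} j _ 1≤j (inj₂ z≤e) =
  ZP.<⇒≱ (x<x+pos (emptyBead c r) 1≤j) (subst (_≤ emptyBead c r) (ZP.+-identityʳ _) z≤e)
leg-gap c r {q ∷ qs} j (qs≤q ∷ dec) 1≤j isBead with j ≤ℕ? q
... | yes j≤q
  with IsBead-∷ (subst (λ l → IsBead c r (q ∷ qs) ((emptyBead c r + + j) - + l))
                       (cong length (LP.filter-accept (j ≤ℕ?_) j≤q)) isBead)
...   | inj₁ eq     = ZP.<-irrefl eq (ZP.<-≤-trans (x-suc<x _ (leg qs j)) (ZP.+-monoʳ-≤ (emptyBead c r) (+≤+ j≤q)))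
...   | inj₂ isBead′ = leg-gap c (suc r) j dec 1≤j (subst (IsBead c (suc r) qs) (next-row c (+ r) (+ j) (+ leg qs j)) isBead′)
  where
  next-row : ∀ c r j l → ((c - (+ 1 + r)) + j) - (+ 1 + l) ≡ ((c - (+ 1 + (+ 1 + r))) + j) - l
  next-row = solve-∀
leg-gap c r {q ∷ qs} j (qs≤q ∷ dec) 1≤j isBead | no j≰q =
  above⇒¬IsBead c r (NP.≤-refl ∷ qs≤q) (ZP.+-monoʳ-< e (+<+ (NP.≰⇒> j≰q)))
    (subst (IsBead c r (q ∷ qs)) (trans (cong (λ l → (e + + j) - + l) leg≡0) (ZP.+-identityʳ (e + + j))) isBead)
  where
  e = emptyBead c r
  leg≡0 : leg (q ∷ qs) j ≡ 0
  leg≡0 = count-none (j ≤ℕ?_) (q ∷ qs) λ where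
    (here refl) j≤q → j≰q j≤q
    (there x∈qs) j≤x → j≰q (NP.≤-trans j≤x (All.lookup qs≤q x∈qs))

hook-gap : ∀ c r {p rest} j → AllPairs _≥ℕ_ (p ∷ rest) → 1 ≤ℕ j → j ≤ℕ p →
  ¬ IsBead c r (p ∷ rest) ((emptyBead c r + + p) - + hook p rest j)
hook-gap c r {rest = rest} j (_ ∷ dec) 1≤j j≤p isBead with d , refl ← NP.m≤n⇒∃[o]m+o≡n j≤p with IsBead-∷ isBead
... | inj₁ eq      = ZP.<-irrefl eq (x-suc<x _ _)
... | inj₂ isBead′ = leg-gap c (suc r) j dec 1≤j (subst (IsBead c (suc r) rest) position≡ isBead′)
  where
  next-row : ∀ c r j d l → ((c - (+ 1 + r)) + (j + d)) - (+ 1 + (d + l)) ≡ ((c - (+ 1 + (+ 1 + r))) + j) - l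
  next-row = solve-∀
  position≡ : (emptyBead c r + + (j +ℕ d)) - + hook (j +ℕ d) rest j ≡ (emptyBead c (suc r) + + j) - + leg rest j
  position≡ = trans (cong (λ m → (emptyBead c r + + (j +ℕ d)) - + suc (m +ℕ leg rest j)) (NP.m+n∸m≡n j d))
                    (next-row c (+ r) (+ j) (+ d) (+ leg rest j))

hook-strict : ∀ p qs {j₁ j₂} → j₁ <ℕ j₂ → j₂ ≤ℕ p → hook p qs j₂ <ℕ hook p qs j₁
hook-strict p qs j₁<j₂ j₂≤p =
  s≤s (NP.+-mono-<-≤ (NP.∸-monoʳ-< j₁<j₂ j₂≤p) (count-mono (_ ≤ℕ?_) (_ ≤ℕ?_) qs (λ _ → NP.≤-trans (NP.<⇒≤ j₁<j₂))))

columns : ℕ → List ℕ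
columns p = map suc (upTo p)

∈-columns : ∀ {p j} → j ∈ columns p → 1 ≤ℕ j × j ≤ℕ p
∈-columns j∈ with i , i∈ , refl ← ∈-map⁻ suc j∈ = s≤s z≤n , ∈-upTo⁻ i∈

gapBelow? : ∀ c r ps a b → Dec (¬ IsBead c r ps (b - + a))
gapBelow? c r ps a b = ¬? (isBead? c r ps (b - + a))

row-hooks≤ : ∀ c r {p rest} a → AllPairs _≥ℕ_ (p ∷ rest) →
  count (_≟ℕ a) (map (hook p rest) (columns p)) ≤ℕ 𝟙 (gapBelow? c r (p ∷ rest) a (emptyBead c r + + p))
row-hooks≤ c r {p} {rest} a dec rewrite count-map (_≟ℕ a) (hook p rest) (columns p)
  with gapBelow? c r (p ∷ rest) a (emptyBead c r + + p)
... | yes _   = count-unique≤1 _ (columns p) (Unique.map⁺ NP.suc-injective (Unique.upTo⁺ p)) same-column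
  where
  same-column : ∀ {j j′} → j ∈ columns p → j′ ∈ columns p → hook p rest j ≡ a → hook p rest j′ ≡ a → j ≡ j′
  same-column {j} {j′} j∈ j′∈ hj hj′ with NP.<-cmp j j′
  ... | tri< j<j′ _ _ = ⊥-elim (NP.<-irrefl (trans hj′ (sym hj)) (hook-strict p rest j<j′ (proj₂ (∈-columns j′∈))))
  ... | tri≈ _ j≡j′ _ = j≡j′
  ... | tri> _ _ j′<j = ⊥-elim (NP.<-irrefl (trans hj (sym hj′)) (hook-strict p rest j′<j (proj₂ (∈-columns j∈))))
... | no ¬gap = NP.≤-reflexive (count-none _ (columns p) λ j∈ hook≡a →
  ¬gap (subst (λ h → ¬ IsBead c r (p ∷ rest) ((emptyBead c r + + p) - + h)) hook≡a
              (hook-gap c r _ dec (proj₁ (∈-columns j∈)) (proj₂ (∈-columns j∈)))))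

hooks≤gaps : ∀ c r {ps} a → AllPairs _≥ℕ_ ps →
  count (_≟ℕ a) (hookLengths ps) ≤ℕ count (gapBelow? c r ps a) (beadsFrom c r ps)
hooks≤gaps c r {[]}       a _                    = z≤n
hooks≤gaps c r {p ∷ rest} a dec@(rest≤p ∷ dec′) = begin
  count (_≟ℕ a) (row ++ hookLengths rest)
    ≡⟨ count-++ (_≟ℕ a) row (hookLengths rest) ⟩
  count (_≟ℕ a) row +ℕ count (_≟ℕ a) (hookLengths rest)
    ≤⟨ NP.+-mono-≤ (row-hooks≤ c r a dec) (hooks≤gaps c (suc r) a dec′) ⟩
  𝟙 (gapBelow? c r (p ∷ rest) a b) +ℕ count (gapBelow? c (suc r) rest a) (beadsFrom c (suc r) rest)
    ≤⟨ NP.+-monoʳ-≤ _ (count-mono (gapBelow? c (suc r) rest a) (gapBelow? c r (p ∷ rest) a) _ gap-in-rest⇒gap) ⟩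
  𝟙 (gapBelow? c r (p ∷ rest) a b) +ℕ count (gapBelow? c r (p ∷ rest) a) (beadsFrom c (suc r) rest)
    ≡⟨ sym (count-∷ (gapBelow? c r (p ∷ rest) a) b (beadsFrom c (suc r) rest)) ⟩
  count (gapBelow? c r (p ∷ rest) a) (beadsFrom c r (p ∷ rest)) ∎
  where
  open NP.≤-Reasoning
  row = map (hook p rest) (columns p)
  b = emptyBead c r + + p
  gap-in-rest⇒gap : ∀ {b′} → b′ ∈ beadsFrom c (suc r) rest →
                    ¬ IsBead c (suc r) rest (b′ - + a) → ¬ IsBead c r (p ∷ rest) (b′ - + a)
  gap-in-rest⇒gap {b′} b′∈ gap isBead with IsBead-∷ isBead
  ... | inj₁ b′-a≡b =
    ZP.<⇒≱ (All.lookup (beadsFrom-below c rest (NP.n<1+n r) rest≤p) b′∈) (subst (_≤ b′) b′-a≡b (ZP.i-j≤i b′ (+ a)))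
  ... | inj₂ isBead′ = gap isBead′

module _ (c d : ℤ) (a m : ℕ) (λ₁ λ₂ : Partition)
         (coreC : IsCore (c + + (a +ℕ m) , c) (λ₁ , λ₂)) (coreD : IsCore (d + + m , d) (λ₁ , λ₂)) where

  private
    ps₁ = parts λ₁
    ps₂ = parts λ₂
    Q = length ps₁ +ℕ length ps₂

    ps₁≤ : ∀ {N} → Q ≤ℕ N → length ps₁ ≤ℕ N
    ps₁≤ = NP.≤-trans (NP.m≤m+n (length ps₁) (length ps₂))

    ps₂≤ : ∀ {N} → Q ≤ℕ N → length ps₂ ≤ℕ N
    ps₂≤ = NP.≤-trans (NP.m≤n+m (length ps₂) (length ps₁))

    Q≤ : ∀ k l → Q ≤ℕ (Q +ℕ k) +ℕ l
    Q≤ k l = NP.≤-trans (NP.m≤m+n Q k) (NP.m≤m+n (Q +ℕ k) l)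

    beads-shift : ∀ {b} → b ∈ beads d ps₂ Q → b - + a ∈ beads (d + + m) ps₁ ((Q +ℕ a) +ℕ m)
    beads-shift {b} b∈ =
      subst₂ (λ z N → z ∈ beads (d + + m) ps₁ N) (recharged≡ b c d (+ a) (+ m)) (sym (NP.+-assoc Q a m))
        (beads-recharge (c + + (a +ℕ m)) (d + + m) ps₁ (Q +ℕ (a +ℕ m))
          (core⇒beads⊆ c (a +ℕ m) λ₁ λ₂ coreC (ps₁≤ (NP.m≤m+n Q _)) (ps₂≤ NP.≤-refl) (beads-recharge d c ps₂ Q b∈)))
      where
      recharged≡ : ∀ b c d a m → (b + (c - d)) + ((d + m) - (c + (a + m))) ≡ b - a
      recharged≡ = solve-∀

  hk₁≤ : hk a λ₁ ≤ℕ m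
  hk₁≤ = NP.≤-trans (hooks≤gaps (d + + m) 0 a (parts-decreasing λ₁))
    (extra-beads≤ d m λ₁ λ₂ coreD (ps₁≤ (NP.m≤m+n Q m)) (ps₂≤ NP.≤-refl)
      (Unique.filter⁺ gap? (beadsFrom-unique (d + + m) λ₁))
      (λ w∈ → beadsFrom⊆beads (d + + m) ps₁ (Q +ℕ m) (proj₁ (∈gaps w∈)))
      (λ w∈ w∈B₂ → proj₂ (∈gaps w∈) (beads⇒IsBead (d + + m) ps₁ _ (beads-shift w∈B₂))))
    where
    gap? = gapBelow? (d + + m) 0 ps₁ a
    ∈gaps : ∀ {w} → w ∈ filter gap? (beadsFrom (d + + m) 0 ps₁) →
            w ∈ beadsFrom (d + + m) 0 ps₁ × ¬ IsBead (d + + m) 0 ps₁ (w - + a)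
    ∈gaps = ∈-filter⁻ gap?

  hk₂≤ : hk a λ₂ ≤ℕ m
  hk₂≤ = NP.≤-trans (hooks≤gaps d 0 a (parts-decreasing λ₂))
    (subst (_≤ℕ m) (LP.length-map (_- + a) gaps)
      (extra-beads≤ d m λ₁ λ₂ coreD (ps₁≤ (Q≤ a m)) (ps₂≤ (NP.m≤m+n Q a))
        (Unique.map⁺ (minus-injective (+ a)) (Unique.filter⁺ gap? (beadsFrom-unique d λ₂)))
        shifted⊆B₁
        shifted∩B₂=∅))
    where
    gap? = gapBelow? d 0 ps₂ a
    gaps = filter gap? (beadsFrom d 0 ps₂)
    ∈gaps : ∀ {b} → b ∈ gaps → b ∈ beadsFrom d 0 ps₂ × ¬ IsBead d 0 ps₂ (b - + a)
    ∈gaps = ∈-filter⁻ gap?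
    minus-injective : ∀ a {x y} → x - a ≡ y - a → x ≡ y
    minus-injective a {x} {y} eq = trans (sym (cancel x a)) (trans (cong (_+ a) eq) (cancel y a))
      where
      cancel : ∀ x a → (x - a) + a ≡ x
      cancel = solve-∀
    shifted⊆B₁ : ∀ {w} → w ∈ map (_- + a) gaps → w ∈ beads (d + + m) ps₁ ((Q +ℕ a) +ℕ m)
    shifted⊆B₁ w∈ with b , b∈ , refl ← ∈-map⁻ (_- + a) w∈ =
      beads-shift (beadsFrom⊆beads d ps₂ Q (proj₁ (∈gaps b∈)))
    shifted∩B₂=∅ : ∀ {w} → w ∈ map (_- + a) gaps → w ∉ beads d ps₂ (Q +ℕ a)
    shifted∩B₂=∅ w∈ w∈B₂ with b , b∈ , refl ← ∈-map⁻ (_- + a) w∈ =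
      proj₂ (∈gaps b∈) (beads⇒IsBead d ps₂ (Q +ℕ a) w∈B₂)

lemma3p8 : (c₁ c₂ d₁ d₂ : ℤ) → + 0 ≤ d₁ - d₂ → d₁ - d₂ < c₁ - c₂ →
    (λ' : Bipartition) → IsCore (c₁ , c₂) λ' → IsCore (d₁ , d₂) λ' →
    let a = ∣ c₁ - c₂ - d₁ + d₂ ∣ in
    (+ hk a (proj₁ λ') ≤ d₁ - d₂) × (+ hk a (proj₂ λ') ≤ d₁ - d₂)
lemma3p8 c₁ c₂ d₁ d₂ 0≤d₁-d₂ d₁-d₂<c₁-c₂ (λ₁ , λ₂) coreC coreD =
  subst (+ hk a λ₁ ≤_) +m≡ (+≤+ (hk₁≤ c₂ d₂ a m λ₁ λ₂ coreC′ coreD′)) ,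
  subst (+ hk a λ₂ ≤_) +m≡ (+≤+ (hk₂≤ c₂ d₂ a m λ₁ λ₂ coreC′ coreD′))
  where
  a = ∣ c₁ - c₂ - d₁ + d₂ ∣
  m = ∣ d₁ - d₂ ∣
  +m≡ : + m ≡ d₁ - d₂
  +m≡ = ZP.0≤i⇒+∣i∣≡i 0≤d₁-d₂
  +a≡ : + a ≡ c₁ - c₂ - d₁ + d₂
  +a≡ = ZP.0≤i⇒+∣i∣≡i (subst (+ 0 ≤_) (regroup c₁ c₂ d₁ d₂) (ZP.i≤j⇒0≤j-i (ZP.<⇒≤ d₁-d₂<c₁-c₂)))
    where
    regroup : ∀ c₁ c₂ d₁ d₂ → (c₁ - c₂) - (d₁ - d₂) ≡ c₁ - c₂ - d₁ + d₂
    regroup = solve-∀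
  c₁≡ : c₁ ≡ c₂ + + (a +ℕ m)
  c₁≡ = sym (trans (cong (λ x → c₂ + x) (cong₂ _+_ +a≡ +m≡)) (telescope c₁ c₂ d₁ d₂))
    where
    telescope : ∀ c₁ c₂ d₁ d₂ → c₂ + ((c₁ - c₂ - d₁ + d₂) + (d₁ - d₂)) ≡ c₁
    telescope = solve-∀
  d₁≡ : d₁ ≡ d₂ + + m
  d₁≡ = sym (trans (cong (λ x → d₂ + x) +m≡) (telescope d₁ d₂))
    where
    telescope : ∀ d₁ d₂ → d₂ + (d₁ - d₂) ≡ d₁
    telescope = solve-∀
  coreC′ = subst (λ c → IsCore (c , c₂) (λ₁ , λ₂)) c₁≡ coreC
  coreD′ = subst (λ d → IsCore (d , d₂) (λ₁ , λ₂)) d₁≡ coreD
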